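{- There are infinitely many $2$-connected $3$-regular graphs $H$ such that, writing $n$ for the number of vertices of $H$, the path cover number satisfies $p(H) \ge n/14$.
   Context: Graphs are finite and simple. A path cover of a graph $G$ is a set of pairwise vertex-disjoint paths in $G$ such that every vertex of $G$ lies on one of the paths (a single vertex counts as a path). The path cover number $p(G)$ is the minimum number of paths in a path cover of $G$. -}

module Defs where

open import Data.Nat using (ℕ; _+_; _≤_)
open import Data.Bool using (Bool; true; false; if_then_else_)
open import Data.Fin using (Fin)
open import Data.List using (List; []; _∷_; allFin; map; length)
open import Data.Nat.ListAction using (sum)
open import Data.List.Membership.Propositional using (_∈_)
open import Data.List.Relation.Unary.Any using (Any)
open import Data.List.Relation.Unary.All using (All)
open import Data.List.Relation.Unary.AllPairs using (AllPairs)
open import Data.List.Relation.Unary.Linked using (Linked)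
open import Data.List.Relation.Unary.Unique.Propositional using (Unique)
open import Data.List.Relation.Binary.Disjoint.Propositional using (Disjoint)
open import Relation.Binary.PropositionalEquality using (_≡_)
open import Relation.Nullary using (¬_)
open import Data.Product using (_×_)
open import Data.Unit using (⊤)

record Graph (n : ℕ) : Set where
  field
    adj   : Fin n → Fin n → Bool
    sym   : ∀ u v → adj u v ≡ adj v u
    irrefl : ∀ v → adj v v ≡ false

open Graph public

Adj : ∀ {n} → Graph n → Fin n → Fin n → Set
Adj G u v = adj G u v ≡ true

degree : ∀ {n} → Graph n → Fin n → ℕ
degree {n} G v = sum (map (λ u → if adj G v u then 1 else 0) (allFin n))

Cubic : ∀ {n} → Graph n → Set
Cubic {n} G = ∀ (v : Fin n) → degree G v ≡ 3

data Walk {n} (G : Graph n) (S : Fin n → Set) : Fin n → Fin n → Set where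
  here : ∀ {u} → S u → Walk G S u u
  step : ∀ {u w v} → S u → Adj G u w → Walk G S w v → Walk G S u v

ConnectedOn : ∀ {n} → Graph n → (Fin n → Set) → Set
ConnectedOn {n} G S = ∀ (u v : Fin n) → S u → S v → Walk G S u v

Connected : ∀ {n} → Graph n → Set
Connected G = ConnectedOn G (λ _ → ⊤)

TwoConnected : ∀ {n} → Graph n → Set
TwoConnected {n} G = (3 ≤ n) × Connected G × (∀ (x : Fin n) → ConnectedOn G (λ v → ¬ (v ≡ x)))

IsPath : ∀ {n} → Graph n → List (Fin n) → Set
IsPath G p = ¬ (p ≡ []) × Unique p × Linked (Adj G) p

PathCover : ∀ {n} → Graph n → List (List (Fin n)) → Set
PathCover {n} G ps = All (IsPath G) ps × AllPairs Disjoint ps × (∀ (v : Fin n) → Any (v ∈_) ps)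

module Submission where

-- For K ≥ 2 let H_K consist of K units arranged in a cycle.  A unit has two
-- connectors A and B and three gadgets, each a copy of K₄ minus the edge between its
-- entry and exit corners; gadgets 1 and 2 join A to B, gadget 3 joins B to the A of the
-- next unit.  H_K is cubic, has n = 14K vertices, and is 2-connected.
--
-- A gadget meets the rest of the graph only in edges to connectors, so every
-- path splits at its connectors into runs inside single gadgets of at most 4 vertices each:
-- a path through c connectors has at most 4 + 5c vertices.  Summing over a path cover by p
-- paths, and using that H_K has only 2K connectors, gives 14K ≤ 4p + 10K, so K ≤ p and
-- n = 14K ≤ 14p.

open import Defs
open import Data.Nat using (ℕ; _≤_; _*_)
open import Data.List using (List; length)
open import Data.Fin using (Fin)
open import Data.Product using (Σ; _×_; ∃-syntax)

open import Data.Nat using (zero; suc; _+_; _<_; z≤n; s≤s)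
import Data.Nat.Properties as ℕ
open import Data.Nat.ListAction using (sum)
open import Data.Nat.Solver using (module +-*-Solver)
open +-*-Solver using (solve; _:+_; _:*_; _:=_; con)
open import Data.Fin using (toℕ; fromℕ; inject₁; lower₁; _≟_) renaming (zero to fzero; suc to fsuc)
open import Data.Fin.Properties
  using ( toℕ-injective; toℕ-fromℕ; toℕ-inject₁; inject₁-lower₁; lower₁-inject₁′; toℕ-inject₁-≢
        ; toℕ≤pred[n]; +↔⊎; *↔×)
open import Data.Fin.Induction using (<-weakInduction)
open import Data.Product using (_,_; proj₁; proj₂)
open import Data.Product.Properties using (≡-dec)
open import Data.Product.Function.NonDependent.Propositional using (_×-↔_)
open import Data.Sum using (_⊎_; inj₁; inj₂)
import Data.Sum.Properties as Sum
open import Data.Sum.Function.Propositional using (_⊎-↔_)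
open import Data.Empty using (⊥; ⊥-elim)
open import Data.Unit using (⊤; tt)
open import Data.Bool using (Bool; true; false; T; not; _∨_; _∧_; if_then_else_)
open import Data.Bool.Properties using (T-∧; T-∨)
open import Data.Bool.ListAction using (all; any)
open import Data.Maybe using (Maybe; just; nothing)
import Data.Maybe as Maybe
import Data.Maybe.Properties as Maybe
open import Data.List using ([]; _∷_; map; allFin; filter; filterᵇ; concat; _++_; cartesianProduct)
open import Data.List.Properties using (length-removeAt′; filter-++; length-++; length-map; length-tabulate; map-∘)
open import Data.List.Membership.Propositional using (_∈_; _∉_; find)
open import Data.List.Membership.Propositional.Properties
  using (∈-allFin; ∈-concat⁺; ∈-map⁺; ∈-map⁻; ∈-++⁺ˡ; ∈-++⁺ʳ; ∈-cartesianProduct⁺)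
open import Data.List.Relation.Unary.Any using (here; there; index; _─_)
open import Data.List.Relation.Unary.Any.Properties using (any⁻)
open import Data.List.Relation.Unary.All as All using (All; []; _∷_)
open import Data.List.Relation.Unary.All.Properties using (all-filter; all⁺)
open import Data.List.Relation.Unary.AllPairs using ([]; _∷_)
open import Data.List.Relation.Unary.Linked as Linked using (Linked; _∷_)
open import Data.List.Relation.Unary.Unique.Propositional using (Unique)
import Data.List.Relation.Unary.Unique.Propositional.Properties as Unique
open import Data.List.Relation.Unary.Unique.DecPropositional using (unique?)
open import Relation.Nullary using (¬_; Dec; yes; no; does)
open import Relation.Nullary.Decidable
  using (does-⇔; dec-true; dec-false; from-yes; map′; ¬?; _⊎-dec_; _×-dec_; T?)
open import Relation.Unary using (Decidable)
open import Relation.Binary using (DecidableEquality)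
open import Relation.Binary.PropositionalEquality
  using (_≡_; _≢_; refl; trans; cong; cong₂; subst; subst₂; module ≡-Reasoning) renaming (sym to ≡-sym)
open import Function using (_∘_)
open import Function.Bundles using (_↔_; Inverse; mk⇔; Equivalence)
open import Function.Construct.Symmetry using (↔-sym)
open import Function.Construct.Composition using (_↔-∘_)
open import Function.Construct.Identity using (↔-id)

walk-start : ∀ {n} {G : Graph n} {S u v} → Walk G S u v → S u
walk-start (here s) = s
walk-start (step s _ _) = s

walk-end : ∀ {n} {G : Graph n} {S u v} → Walk G S u v → S v
walk-end (here s) = s
walk-end (step _ _ w) = walk-end w

infixr 5 _▸_
_▸_ : ∀ {n} {G : Graph n} {S u v w} → Walk G S u v → Walk G S v w → Walk G S u w
here _ ▸ w′ = w′
step s e w ▸ w′ = step s e (w ▸ w′)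

adj-sym : ∀ {n} {G : Graph n} {u v} → Adj G u v → Adj G v u
adj-sym {G = G} {u} {v} e = trans (sym G v u) e

reverse : ∀ {n} {G : Graph n} {S u v} → Walk G S u v → Walk G S v u
reverse (here s) = here s
reverse {G = G} (step s e w) = reverse w ▸ step (walk-start w) (adj-sym {G = G} e) (here s)

map-walk : ∀ {n m} {G : Graph n} {H : Graph m} {S : Fin n → Set} {T : Fin m → Set}
           (f : Fin n → Fin m) → (∀ {x y} → Adj G x y → Adj H (f x) (f y)) →
           (∀ {x} → S x → T (f x)) → ∀ {u v} → Walk G S u v → Walk H T (f u) (f v)
map-walk f f-adj f-S (here s) = here (f-S s)
map-walk f f-adj f-S (step s e w) = step (f-S s) (f-adj e) (map-walk f f-adj f-S w)

weaken : ∀ {n} {G : Graph n} {S T : Fin n → Set} → (∀ {x} → S x → T x) →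
         ∀ {u v} → Walk G S u v → Walk G T u v
weaken = map-walk (λ x → x) (λ e → e)

ConnectedWithout : ∀ {n} → Graph n → Fin n → Set
ConnectedWithout G x = ConnectedOn G (λ v → ¬ v ≡ x)

third-vertex : ∀ {n} {c₁ c₂ c₃ : Fin n} → c₁ ≢ c₂ → c₁ ≢ c₃ → c₂ ≢ c₃ →
               ∀ u v → ∃[ c ] (u ≢ c × v ≢ c)
third-vertex {c₁ = c₁} {c₂} {c₃} d₁₂ d₁₃ d₂₃ u v with u ≟ c₁ | v ≟ c₁ | u ≟ c₂ | v ≟ c₂
... | no u≢c₁ | no v≢c₁ | _ | _ = c₁ , u≢c₁ , v≢c₁
... | _ | _ | no u≢c₂ | no v≢c₂ = c₂ , u≢c₂ , v≢c₂
... | yes refl | _ | _ | yes refl = c₃ , d₁₃ , d₂₃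
... | _ | yes refl | yes refl | _ = c₃ , d₂₃ , d₁₃
... | yes refl | _ | yes u≡c₂ | _ = ⊥-elim (d₁₂ u≡c₂)
... | _ | yes refl | _ | yes v≡c₂ = ⊥-elim (d₁₂ v≡c₂)

connected-if-robust : ∀ {n} {G : Graph n} {c₁ c₂ c₃ : Fin n} → c₁ ≢ c₂ → c₁ ≢ c₃ → c₂ ≢ c₃ →
                      (∀ x → ConnectedWithout G x) → Connected G
connected-if-robust d₁₂ d₁₃ d₂₃ robust u v _ _ with third-vertex d₁₂ d₁₃ d₂₃ u v
... | c , u≢c , v≢c = weaken (λ _ → tt) (robust c u v u≢c v≢c)

robust-transport : ∀ {n} {G : Graph n} (σ τ : Fin n → Fin n) →
                   (∀ v → σ (τ v) ≡ v) → (∀ v → τ (σ v) ≡ v) →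
                   (∀ {u v} → Adj G u v → Adj G (σ u) (σ v)) →
                   ∀ x → ConnectedWithout G x → ConnectedWithout G (σ x)
robust-transport {G = G} σ τ στ τσ σ-adj x robust u v u≢σx v≢σx =
  subst₂ (Walk G _) (στ u) (στ v)
    (map-walk σ σ-adj (λ {w} w≢x σw≡σx → w≢x (pulled-back σw≡σx))
      (robust (τ u) (τ v) (λ e → u≢σx (pushed e)) (λ e → v≢σx (pushed e))))
  where
  pulled-back : ∀ {w} → σ w ≡ σ x → w ≡ x
  pulled-back {w} e = trans (≡-sym (τσ w)) (trans (cong τ e) (τσ x))
  pushed : ∀ {w} → τ w ≡ x → w ≡ σ x
  pushed {w} e = trans (≡-sym (στ w)) (cong σ e)

module Cyclic {k : ℕ} where

  prev : Fin (suc k) → Fin (suc k)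
  prev fzero = fromℕ k
  prev (fsuc i) = inject₁ i

  next-by : (i : Fin (suc k)) → Dec (k ≡ toℕ i) → Fin (suc k)
  next-by i (yes _) = fzero
  next-by i (no i≢last) = fsuc (lower₁ i i≢last)

  next : Fin (suc k) → Fin (suc k)
  next i = next-by i (k ℕ.≟ toℕ i)

  prev-next : ∀ i → prev (next i) ≡ i
  prev-next i = prev-next-by (k ℕ.≟ toℕ i)
    where
    prev-next-by : ∀ d → prev (next-by i d) ≡ i
    prev-next-by (yes last) = toℕ-injective (trans (toℕ-fromℕ k) last)
    prev-next-by (no i≢last) = inject₁-lower₁ i i≢last

  next-last : next (fromℕ k) ≡ fzero
  next-last = next-last-by (k ℕ.≟ toℕ (fromℕ k))
    where
    next-last-by : ∀ d → next-by (fromℕ k) d ≡ fzero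
    next-last-by (yes _) = refl
    next-last-by (no not-last) = ⊥-elim (not-last (≡-sym (toℕ-fromℕ k)))

  next-inject₁ : ∀ i → next (inject₁ i) ≡ fsuc i
  next-inject₁ i = next-inject₁-by (k ℕ.≟ toℕ (inject₁ i))
    where
    next-inject₁-by : ∀ d → next-by (inject₁ i) d ≡ fsuc i
    next-inject₁-by (yes last) = ⊥-elim (toℕ-inject₁-≢ i last)
    next-inject₁-by (no not-last) = cong fsuc (lower₁-inject₁′ i not-last)

  next-prev : ∀ i → next (prev i) ≡ i
  next-prev fzero = next-last
  next-prev (fsuc i) = next-inject₁ i

  cyclic-induction : (P : Fin (suc k) → Set) → P (fromℕ k) → (∀ i → P i → P (next i)) → ∀ i → P i
  cyclic-induction P last advance =
    <-weakInduction P (subst P next-last (advance _ last)) (λ i h → subst P (next-inject₁ i) (advance _ h))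

∈-─ : ∀ {A : Set} {x w : A} {ys} (x∈ys : x ∈ ys) → w ∈ ys → w ≢ x → w ∈ (ys ─ x∈ys)
∈-─ (here refl) (here refl) w≢x = ⊥-elim (w≢x refl)
∈-─ (here refl) (there w∈ys) _ = w∈ys
∈-─ (there _) (here refl) _ = here refl
∈-─ (there x∈ys) (there w∈ys) w≢x = there (∈-─ x∈ys w∈ys w≢x)

unique-⊆-length : ∀ {A : Set} {xs ys : List A} → Unique xs → (∀ {v} → v ∈ xs → v ∈ ys) →
                  length xs ≤ length ys
unique-⊆-length {xs = []} _ _ = z≤n
unique-⊆-length {xs = x ∷ xs} {ys} (x∉xs ∷ unique) xs⊆ys =
  subst (suc (length xs) ≤_) (≡-sym (length-removeAt′ ys (index x∈ys)))
    (s≤s (unique-⊆-length unique (λ v∈xs → ∈-─ x∈ys (xs⊆ys (there v∈xs)) (x≢ v∈xs))))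
  where
  x≢ : ∀ {v} → v ∈ xs → v ≢ x
  x≢ v∈xs v≡x = All.lookup x∉xs v∈xs (≡-sym v≡x)
  x∈ys : x ∈ ys
  x∈ys = xs⊆ys (here refl)

-- The number of entries of a list satisfying a decidable predicate, as a sum of indicators
-- (this is the shape of the degree in the definition of a graph).
tally : ∀ {A : Set} {P : A → Set} → Decidable P → List A → ℕ
tally P? xs = sum (map (λ u → if does (P? u) then 1 else 0) xs)

tally-none : ∀ {A : Set} {P : A → Set} (P? : Decidable P) xs → (∀ {u} → u ∈ xs → ¬ P u) → tally P? xs ≡ 0
tally-none P? [] _ = refl
tally-none P? (x ∷ xs) none with P? x
... | yes Px = ⊥-elim (none (here refl) Px)
... | no _ = tally-none P? xs (λ u∈xs → none (there u∈xs))

tally-one : ∀ {A : Set} {P : A → Set} (P? : Decidable P) {c} xs → Unique xs → c ∈ xs →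
            P c → (∀ {u} → P u → u ≡ c) → tally P? xs ≡ 1
tally-one P? (x ∷ xs) (x∉xs ∷ _) (here refl) Pc only with P? x
... | yes _ = cong suc (tally-none P? xs (λ u∈xs Pu → All.lookup x∉xs u∈xs (≡-sym (only Pu))))
... | no ¬Px = ⊥-elim (¬Px Pc)
tally-one P? (x ∷ xs) (x∉xs ∷ unique) (there c∈xs) Pc only with P? x
... | yes Px = ⊥-elim (All.lookup x∉xs c∈xs (only Px))
... | no _ = tally-one P? xs unique c∈xs Pc only

tally-∨ : ∀ {A : Set} {P Q R : A → Set} (P? : Decidable P) (Q? : Decidable Q) (R? : Decidable R) xs →
          (∀ u → does (R? u) ≡ (does (P? u) ∨ does (Q? u))) → (∀ u → P u → Q u → ⊥) →
          tally R? xs ≡ tally P? xs + tally Q? xs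
tally-∨ P? Q? R? [] _ _ = refl
tally-∨ P? Q? R? (x ∷ xs) R≡P∨Q disjoint
  rewrite R≡P∨Q x | tally-∨ P? Q? R? xs R≡P∨Q disjoint with P? x | Q? x
... | yes Px | yes Qx = ⊥-elim (disjoint x Px Qx)
... | yes _ | no _ = refl
... | no _ | yes _ = ≡-sym (ℕ.+-suc (tally P? xs) (tally Q? xs))
... | no _ | no _ = refl

module NeighbourListGraph {V : Set} {n : ℕ} (V↔Fin : V ↔ Fin n) (_≟ᵥ_ : DecidableEquality V)
  (nbrs : V → List V)
  (nbrs-sym : ∀ {u v} → v ∈ nbrs u → u ∈ nbrs v)
  (nbrs-irrefl : ∀ v → v ∉ nbrs v) where

  open Inverse V↔Fin public using (to; from)
  open import Data.List.Membership.DecPropositional _≟ᵥ_ using (_∈?_)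

  to-from : ∀ x → to (from x) ≡ x
  to-from = Inverse.strictlyInverseˡ V↔Fin

  from-to : ∀ v → from (to v) ≡ v
  from-to = Inverse.strictlyInverseʳ V↔Fin

  graph : Graph n
  graph = record
    { adj = λ x y → does (from y ∈? nbrs (from x))
    ; sym = λ x y → does-⇔ (mk⇔ nbrs-sym nbrs-sym) (from y ∈? nbrs (from x)) (from x ∈? nbrs (from y))
    ; irrefl = λ x → dec-false (from x ∈? nbrs (from x)) (nbrs-irrefl (from x))
    }

  adjacent⇒∈ : ∀ {x y} → Adj graph x y → from y ∈ nbrs (from x)
  adjacent⇒∈ {x} {y} e with from y ∈? nbrs (from x)
  ... | yes y∈ = y∈

  ∈⇒adjacent : ∀ {u v} → v ∈ nbrs u → Adj graph (to u) (to v)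
  ∈⇒adjacent {u} {v} v∈ = dec-true (from (to v) ∈? nbrs (from (to u)))
                                     (subst₂ (λ a b → a ∈ nbrs b) (≡-sym (from-to v)) (≡-sym (from-to u)) v∈)

  degree-graph : ∀ x → Unique (nbrs (from x)) → degree graph x ≡ length (nbrs (from x))
  degree-graph x = count (nbrs (from x))
    where
    open ≡-Reasoning
    count : ∀ L → Unique L → tally (λ u → from u ∈? L) (allFin n) ≡ length L
    count [] _ = tally-none (λ u → from u ∈? []) (allFin n) (λ _ ())
    count (a ∷ L) (a∉L ∷ unique) = begin
      tally (λ u → from u ∈? a ∷ L) (allFin n)
        ≡⟨ tally-∨ (λ u → from u ≟ᵥ a) (λ u → from u ∈? L) (λ u → from u ∈? a ∷ L) (allFin n)
                   (λ _ → refl) (λ u u≡a u∈L → All.lookup a∉L (subst (_∈ L) u≡a u∈L) refl) ⟩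
      tally (λ u → from u ≟ᵥ a) (allFin n) + tally (λ u → from u ∈? L) (allFin n)
        ≡⟨ cong₂ _+_ (tally-one (λ u → from u ≟ᵥ a) (allFin n) (Unique.allFin⁺ n) (∈-allFin (to a)) (from-to a)
                                (λ {u} u≡a → trans (≡-sym (to-from u)) (cong to u≡a)))
                     (count L unique) ⟩
      suc (length L) ∎

-- Path covers of a graph whose vertices are either connectors or lie in blobs of at most c
-- vertices, with no edge joining two different blobs.  A path then alternates between runs
-- inside single blobs and connectors, so it has at most c + (c+1)·(#connectors) vertices.
module BlobBound {n} (G : Graph n) {Label : Set} (blob : Fin n → Maybe Label)
  (blob-edge : ∀ {u v ℓ ℓ′} → Adj G u v → blob u ≡ just ℓ → blob v ≡ just ℓ′ → ℓ ≡ ℓ′)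
  (c : ℕ) (blob-size : ∀ ℓ {us} → Unique us → All (λ u → blob u ≡ just ℓ) us → length us ≤ c) where

  IsConnector : Fin n → Set
  IsConnector u = blob u ≡ nothing

  connector? : Decidable IsConnector
  connector? u with blob u
  ... | nothing = yes refl
  ... | just _ = no λ ()

  not-connector : ∀ {v ℓ} → blob v ≡ just ℓ → ¬ IsConnector v
  not-connector bv bv′ with () ← trans (≡-sym bv) bv′

  connectors : List (Fin n) → List (Fin n)
  connectors = filter connector?

  -- The blob of the currently open run of a path, if any (`nothing`: no open run).
  InRun : Maybe Label → Fin n → Set
  InRun (just ℓ) u = blob u ≡ just ℓ
  InRun nothing u = ⊥

  run-size : ∀ m {run} → Unique run → All (InRun m) run → length run ≤ c
  run-size (just ℓ) unique in-ℓ = blob-size ℓ unique in-ℓ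
  run-size nothing _ [] = z≤n

  Continues : Maybe Label → List (Fin n) → Set
  Continues (just ℓ) (w ∷ _) = ∀ {ℓ′} → blob w ≡ just ℓ′ → ℓ′ ≡ ℓ
  Continues _ _ = ⊤

  continues : ∀ {v P ℓ} → Linked (Adj G) (v ∷ P) → blob v ≡ just ℓ → Continues (just ℓ) P
  continues {P = []} _ _ = tt
  continues {P = w ∷ P} (e ∷ _) bv bw = ≡-sym (blob-edge e bv bw)

  extend-run : ∀ m {v P ℓ run} → Continues m (v ∷ P) → blob v ≡ just ℓ → All (InRun m) run →
               All (InRun (just ℓ)) run
  extend-run nothing _ _ [] = []
  extend-run (just ℓ₀) cont bv in-ℓ₀ = All.map (λ bu → trans bu (cong just (≡-sym (cont bv)))) in-ℓ₀

  close-run : ∀ {r l k} → r ≤ c → l ≤ c + suc c * k → r + suc l ≤ c + suc c * suc k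
  close-run {r} {l} {k} r≤c l≤ =
    subst (r + suc l ≤_) (cong (c +_) (≡-sym (ℕ.*-suc (suc c) k))) (ℕ.+-mono-≤ r≤c (s≤s l≤))

  run-bound : ∀ m run P → Unique run → All (InRun m) run → All (_∉ P) run →
              Unique P → Linked (Adj G) P → Continues m P →
              length run + length P ≤ c + suc c * length (connectors P)
  run-bound m run [] unique-run in-m _ _ _ _ =
    ℕ.≤-trans (ℕ.≤-reflexive (ℕ.+-identityʳ (length run))) (ℕ.≤-trans (run-size m unique-run in-m) (ℕ.m≤m+n c _))
  run-bound m run (v ∷ P) unique-run in-m disjoint (v∉P ∷ unique) linked cont with blob v in bv
  ... | nothing = close-run (run-size m unique-run in-m) (run-bound nothing [] P [] [] [] unique (Linked.tail linked) tt)
  ... | just ℓ =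
    subst (_≤ c + suc c * length (connectors P)) (≡-sym (ℕ.+-suc (length run) (length P)))
      (run-bound (just ℓ) (v ∷ run) P
        (All.map (λ u∉vP v≡u → u∉vP (here (≡-sym v≡u))) disjoint ∷ unique-run)
        (bv ∷ extend-run m cont bv in-m)
        ((λ v∈P → All.lookup v∉P v∈P refl) ∷ All.map (λ u∉vP u∈P → u∉vP (there u∈P)) disjoint)
        unique (Linked.tail linked) (continues linked bv))

  path-bound : ∀ {P} → IsPath G P → length P ≤ c + suc c * length (connectors P)
  path-bound {P} (_ , unique , linked) = run-bound nothing [] P [] [] [] unique linked tt

  paths-bound : ∀ {ps} → All (IsPath G) ps →
                length (concat ps) ≤ c * length ps + suc c * length (connectors (concat ps))
  paths-bound {[]} [] = z≤n
  paths-bound {P ∷ ps} (path ∷ paths) =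
    subst₂ _≤_ (≡-sym (length-++ P)) regroup
      (ℕ.+-mono-≤ (path-bound path) (paths-bound paths))
    where
    k k′ : ℕ
    k = length (connectors P)
    k′ = length (connectors (concat ps))
    regroup : c + suc c * k + (c * length ps + suc c * k′)
              ≡ c * suc (length ps) + suc c * length (connectors (P ++ concat ps))
    regroup rewrite filter-++ connector? P (concat ps) | length-++ (connectors P) {connectors (concat ps)} =
      solve 5 (λ c s k k′ p → c :+ s :* k :+ (c :* p :+ s :* k′) := c :* (con 1 :+ p) :+ s :* (k :+ k′))
            refl c (suc c) k k′ (length ps)

  cover-bound : ∀ {ps} x → (∀ {us} → Unique us → All IsConnector us → length us ≤ x) →
                PathCover G ps → n ≤ c * length ps + suc c * x
  cover-bound {ps} x few-connectors (paths , disjoint , covers) =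
    ℕ.≤-trans all-vertices
      (ℕ.≤-trans (paths-bound paths) (ℕ.+-monoʳ-≤ (c * length ps) (ℕ.*-monoʳ-≤ (suc c) at-most-x)))
    where
    unique-vertices : Unique (concat ps)
    unique-vertices = Unique.concat⁺ (All.map (λ path → proj₁ (proj₂ path)) paths) disjoint
    unique-connectors : Unique (connectors (concat ps))
    unique-connectors = Unique.filter⁺ connector? unique-vertices
    at-most-x : length (connectors (concat ps)) ≤ x
    at-most-x = few-connectors unique-connectors (all-filter connector? (concat ps))
    all-vertices : n ≤ length (concat ps)
    all-vertices = subst (_≤ length (concat ps)) (length-tabulate (λ i → i))
                     (unique-⊆-length (Unique.allFin⁺ n) (λ {v} _ → ∈-concat⁺ (covers v)))

Corner Gadget : Set
Corner = Fin 4
Gadget = Fin 3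

Pos : Set
Pos = Fin 2 ⊎ (Corner × Gadget)

pattern A = inj₁ fzero
pattern B = inj₁ (fsuc fzero)
pattern entry = fzero
pattern exit = fsuc fzero
pattern inner₁ = fsuc (fsuc fzero)
pattern inner₂ = fsuc (fsuc (fsuc fzero))
pattern g₁ = fzero
pattern g₂ = fsuc fzero
pattern g₃ = fsuc (fsuc fzero)
infix 5 _at_
pattern _at_ c g = inj₂ (c , g)

_≟ₚ_ : DecidableEquality Pos
_≟ₚ_ = Sum.≡-dec _≟_ (≡-dec _≟_ _≟_)

Pos↔Fin : Pos ↔ Fin 14
Pos↔Fin = ↔-sym (+↔⊎ {2} {12}) ↔-∘ (↔-id _ ⊎-↔ ↔-sym (*↔× {4} {3}))

allPos : List Pos
allPos = map inj₁ (allFin 2) ++ map inj₂ (cartesianProduct (allFin 4) (allFin 3))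

∈-allPos : ∀ p → p ∈ allPos
∈-allPos (inj₁ b) = ∈-++⁺ˡ (∈-map⁺ inj₁ (∈-allFin b))
∈-allPos (inj₂ (c , g)) =
  ∈-++⁺ʳ (map inj₁ (allFin 2)) (∈-map⁺ inj₂ (∈-cartesianProduct⁺ (∈-allFin c) (∈-allFin g)))

all-Pos? : ∀ {P : Pos → Set} → Decidable P → Dec (∀ p → P p)
all-Pos? P? = map′ (λ all p → All.lookup all (∈-allPos p)) (λ h → All.tabulate (λ {p} _ → h p)) (All.all? P? allPos)

every-Pos : ∀ (f : Pos → Bool) → T (all f allPos) → ∀ p → T (f p)
every-Pos f holds p = All.lookup (all⁺ f allPos holds) (∈-allPos p)

-- An edge leaves a position towards the same, the previous or the next unit.
Offset : Set
Offset = Fin 3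

pattern same = fzero
pattern back = fsuc fzero
pattern fwd = fsuc (fsuc fzero)

opposite : Offset → Offset
opposite same = same
opposite back = fwd
opposite fwd = back

Port : Set
Port = Offset × Pos

_≟ₗ_ : DecidableEquality Port
_≟ₗ_ = ≡-dec _≟_ _≟ₚ_

open import Data.List.Membership.DecPropositional _≟ₗ_ using (_∈?_)
open import Data.List.Membership.DecPropositional _≟ₚ_ using () renaming (_∈?_ to _∈ₚ?_)

-- Each gadget is K₄ minus the edge entry–exit.  Gadgets 1 and 2 run from A to B,
-- gadget 3 runs from B to the A of the next unit.
entry-port exit-port : Gadget → Port
entry-port g₁ = same , A
entry-port g₂ = same , A
entry-port g₃ = same , B
exit-port g₁ = same , B
exit-port g₂ = same , B
exit-port g₃ = fwd , A

ports : Pos → List Port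
ports A = (same , entry at g₁) ∷ (same , entry at g₂) ∷ (back , exit at g₃) ∷ []
ports B = (same , exit at g₁) ∷ (same , exit at g₂) ∷ (same , entry at g₃) ∷ []
ports (entry at g) = entry-port g ∷ (same , inner₁ at g) ∷ (same , inner₂ at g) ∷ []
ports (exit at g) = exit-port g ∷ (same , inner₁ at g) ∷ (same , inner₂ at g) ∷ []
ports (inner₁ at g) = (same , entry at g) ∷ (same , exit at g) ∷ (same , inner₂ at g) ∷ []
ports (inner₂ at g) = (same , entry at g) ∷ (same , exit at g) ∷ (same , inner₁ at g) ∷ []

gadget-of : Pos → Maybe Gadget
gadget-of (inj₁ _) = nothing
gadget-of (_ at g) = just g

ports-symmetric : ∀ p → All (λ l → (opposite (proj₁ l) , p) ∈ ports (proj₂ l)) (ports p)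
ports-symmetric = from-yes (all-Pos? (λ p → All.all? (λ l → (opposite (proj₁ l) , p) ∈? ports (proj₂ l)) (ports p)))

ports-loopless : ∀ p → All (λ l → proj₂ l ≢ p) (ports p)
ports-loopless = from-yes (all-Pos? (λ p → All.all? (λ l → ¬? (proj₂ l ≟ₚ p)) (ports p)))

ports-distinct : ∀ p → Unique (map proj₂ (ports p))
ports-distinct = from-yes (all-Pos? (λ p → unique? _≟ₚ_ (map proj₂ (ports p))))

ports-three : ∀ p → length (ports p) ≡ 3
ports-three = from-yes (all-Pos? (λ p → length (ports p) ℕ.≟ 3))

SameGadget : Pos → Port → Set
SameGadget p (o , q) = gadget-of p ≡ nothing ⊎ gadget-of q ≡ nothing ⊎ (o ≡ same × gadget-of q ≡ gadget-of p)

ports-gadgets : ∀ p → All (SameGadget p) (ports p)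
ports-gadgets = from-yes (all-Pos? (λ p → All.all? (λ l → Maybe.≡-dec _≟_ (gadget-of p) nothing
                    ⊎-dec Maybe.≡-dec _≟_ (gadget-of (proj₂ l)) nothing
                    ⊎-dec (proj₁ l ≟ same ×-dec Maybe.≡-dec _≟_ (gadget-of (proj₂ l)) (gadget-of p))) (ports p)))

not-both : ∀ b → T (not b) → T b → ⊥
not-both true () _

T-does : ∀ {P : Set} (d : Dec P) → T (does d) → P
T-does (yes p) _ = p
T-does (no _) ()

is-same : Offset → Bool
is-same same = true
is-same _ = false

is-same-sound : ∀ o → T (is-same o) → o ≡ same
is-same-sound same _ = refl

-- Backward breadth-first search inside one unit, on positions only: `allowed` marks the usable
-- positions and `target` the goals; `reached` collects the usable positions from which a
-- target is reachable through same-unit ports.  The search is certified: for any family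
-- Goal that holds at targets and propagates backwards along same-unit ports, `reach`
-- produces a Goal for every usable position once `complete` evaluates to true.
module LocalSearch (allowed target : Pos → Bool) where

  extends : List Pos → Pos → Bool
  extends R s = allowed s ∧ (target s ∨ any (λ l → is-same (proj₁ l) ∧ does (proj₂ l ∈ₚ? R)) (ports s))

  rounds : ℕ → List Pos → List Pos
  rounds zero R = R
  rounds (suc k) R = rounds k (filterᵇ (extends R) allPos)

  -- 14 rounds, enough for the 14 positions of a unit (completeness is checked, not assumed)
  reached : List Pos
  reached = rounds 14 []

  covered : Pos → Bool
  covered s = not (allowed s) ∨ does (s ∈ₚ? reached)

  complete : Bool
  complete = all covered allPos

  module Sound (Goal : Pos → Set)
    (at-target : ∀ {s} → T (allowed s) → T (target s) → Goal s)
    (prepend : ∀ {s q} → T (allowed s) → (same , q) ∈ ports s → Goal q → Goal s) where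

    extends-sound : ∀ {R} → All Goal R → ∀ s → T (extends R s) → Goal s
    extends-sound {R} goals s h with Equivalence.to T-∧ h
    ... | ok , h′ with Equivalence.to T-∨ h′
    ...   | inj₁ is-target = at-target ok is-target
    ...   | inj₂ via-nbr with find (any⁻ _ (ports s) via-nbr)
    ...     | (o , q) , l∈ , h″ with Equivalence.to T-∧ h″
    ...       | o-same , q∈R =
      prepend ok (subst (λ o → (o , q) ∈ ports s) (is-same-sound o o-same) l∈) (All.lookup goals (T-does (q ∈ₚ? R) q∈R))

    rounds-sound : ∀ k {R} → All Goal R → All Goal (rounds k R)
    rounds-sound zero goals = goals
    rounds-sound (suc k) {R} goals =
      rounds-sound k (All.map (λ {s} → extends-sound goals s) (all-filter (T? ∘ extends R) allPos))

    reach : T complete → ∀ s → T (allowed s) → Goal s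
    reach done s ok with Equivalence.to T-∨ (every-Pos covered done s)
    ... | inj₁ not-ok = ⊥-elim (not-both (allowed s) not-ok ok)
    ... | inj₂ s∈ = All.lookup (rounds-sound 14 All.[]) (T-does (s ∈ₚ? reached) s∈)

avoiding : Pos → Pos → Bool
avoiding t s = not (does (s ≟ₚ t))

avoiding-sound : ∀ {t s} → T (avoiding t s) → s ≢ t
avoiding-sound {t} h refl = subst (T ∘ not) (dec-true (t ≟ₚ t) refl) h

avoiding-complete : ∀ {t s} → s ≢ t → T (avoiding t s)
avoiding-complete {t} {s} s≢t = subst (T ∘ not) (≡-sym (dec-false (s ≟ₚ t) s≢t)) tt

-- the two positions through which walks leave a unit towards unit 0
exit-point : Pos → Bool
exit-point s = does (s ≟ₚ A) ∨ does (s ≟ₚ (exit at g₃))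

is-A : Pos → Bool
is-A s = does (s ≟ₚ A)

-- The search results, evaluated once here and kept opaque elsewhere: inside a unit every
-- position reaches A, and after deleting any position t every other position still
-- reaches an exit point.
opaque
  to-A-complete : T (LocalSearch.complete (λ _ → true) is-A)
  to-A-complete = tt

  escape-complete : ∀ t → T (LocalSearch.complete (avoiding t) exit-point)
  escape-complete = every-Pos (λ t → LocalSearch.complete (avoiding t) exit-point) tt

fourteen-bound : ∀ k p → k * 14 ≤ 4 * p + 5 * (k + k) → k * 14 ≤ 14 * p
fourteen-bound k p bound = subst (_≤ 14 * p) (ℕ.*-comm 14 k) (ℕ.*-monoʳ-≤ 14 k≤p)
  where
  split : k * 14 ≡ 4 * k + 10 * k
  split = solve 1 (λ k → k :* con 14 := con 4 :* k :+ con 10 :* k) refl k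
  merge : 4 * p + 5 * (k + k) ≡ 4 * p + 10 * k
  merge = solve 2 (λ p k → con 4 :* p :+ con 5 :* (k :+ k) := con 4 :* p :+ con 10 :* k) refl p k
  k≤p : k ≤ p
  k≤p = ℕ.*-cancelˡ-≤ 4 (ℕ.+-cancelʳ-≤ (10 * k) (4 * k) (4 * p) (subst₂ _≤_ split merge bound))

module Construction (m : ℕ) where
  open Cyclic {suc m}

  K : ℕ
  K = suc (suc m)

  n : ℕ
  n = K * 14

  Vertex : Set
  Vertex = Fin K × Pos

  -- (opaque: only the inverse laws of this bijection are ever used)
  opaque
    Vertex↔Fin : Vertex ↔ Fin n
    Vertex↔Fin = ↔-sym (*↔× {K} {14}) ↔-∘ (↔-id _ ×-↔ Pos↔Fin)

  _≟ᵥ_ : DecidableEquality Vertex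
  _≟ᵥ_ = ≡-dec _≟_ _≟ₚ_

  shift : Offset → Fin K → Fin K
  shift same i = i
  shift back i = prev i
  shift fwd i = next i

  shift-opposite : ∀ o i → shift (opposite o) (shift o i) ≡ i
  shift-opposite same i = refl
  shift-opposite back i = next-prev i
  shift-opposite fwd i = prev-next i

  shift-next : ∀ o i → shift o (next i) ≡ next (shift o i)
  shift-next same i = refl
  shift-next back i = trans (prev-next i) (≡-sym (next-prev i))
  shift-next fwd i = refl

  follow : Fin K → Port → Vertex
  follow i (o , q) = shift o i , q

  nbrs : Vertex → List Vertex
  nbrs (i , p) = map (follow i) (ports p)

  nbrs-sym : ∀ {u v} → v ∈ nbrs u → u ∈ nbrs v
  nbrs-sym {i , p} v∈ with ∈-map⁻ (follow i) v∈
  ... | (o , q) , l∈ , refl =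
    subst (λ j → (j , p) ∈ nbrs (shift o i , q)) (shift-opposite o i)
      (∈-map⁺ (follow (shift o i)) (All.lookup (ports-symmetric p) l∈))

  nbrs-irrefl : ∀ v → v ∉ nbrs v
  nbrs-irrefl (i , p) v∈ with ∈-map⁻ (follow i) v∈
  ... | (o , q) , l∈ , eq = All.lookup (ports-loopless p) l∈ (≡-sym (cong proj₂ eq))

  nbrs-unique : ∀ v → Unique (nbrs v)
  nbrs-unique (i , p) = Unique.map⁻ (subst Unique (map-∘ {g = proj₂} {f = follow i} (ports p)) (ports-distinct p))

  open NeighbourListGraph Vertex↔Fin _≟ᵥ_ nbrs nbrs-sym nbrs-irrefl public renaming (graph to G)

  vertex : Fin K → Pos → Fin n
  vertex i p = to (i , p)

  vertex-injective : ∀ {v w} → to v ≡ to w → v ≡ w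
  vertex-injective {v} {w} e = trans (≡-sym (from-to v)) (trans (cong from e) (from-to w))

  cubic : Cubic G
  cubic x = trans (degree-graph x (nbrs-unique (from x)))
                  (trans (length-map (follow (proj₁ (from x))) (ports (proj₂ (from x)))) (ports-three (proj₂ (from x))))

  port-edge : ∀ i p o q → (o , q) ∈ ports p → Adj G (vertex i p) (vertex (shift o i) q)
  port-edge i p o q l∈ = ∈⇒adjacent (∈-map⁺ (follow i) l∈)

  local-edge : ∀ i {p q} → (same , q) ∈ ports p → Adj G (vertex i p) (vertex i q)
  local-edge i {p} {q} = port-edge i p same q

  InUnit : Fin K → (Pos → Set) → Fin n → Set
  InUnit i Ok v = ∃[ p ] (Ok p × v ≡ vertex i p)

  Escape : Fin K → Pos → Pos → Set
  Escape i t s = Walk G (InUnit i (_≢ t)) (vertex i s) (vertex i A)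
               ⊎ Walk G (InUnit i (_≢ t)) (vertex i s) (vertex i (exit at g₃))

  -- The two certified searches.  They are opaque: unfolding them would re-run the searches.
  opaque
    to-A : ∀ i s → Walk G (InUnit i (λ _ → ⊤)) (vertex i s) (vertex i A)
    to-A i s = reach to-A-complete s tt
      where
      ToA : Pos → Set
      ToA s = Walk G (InUnit i (λ _ → ⊤)) (vertex i s) (vertex i A)

      at-A : ∀ {s} → ⊤ → T (is-A s) → ToA s
      at-A {s} _ s-is-A with refl ← T-does (s ≟ₚ A) s-is-A = here (A , tt , refl)

      open LocalSearch (λ _ → true) is-A
      open Sound ToA (λ {s} → at-A {s}) (λ {s} _ l∈ w → step (s , tt , refl) (local-edge i l∈) w)

    escape : ∀ i t s → s ≢ t → Escape i t s
    escape i t s s≢t = reach (escape-complete t) s (avoiding-complete s≢t)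
      where
      open LocalSearch (avoiding t) exit-point

      at-exit : ∀ {s} → T (avoiding t s) → T (exit-point s) → Escape i t s
      at-exit {s} ok is-exit with Equivalence.to T-∨ is-exit
      ... | inj₁ s-is-A with refl ← T-does (s ≟ₚ A) s-is-A = inj₁ (here (A , avoiding-sound ok , refl))
      ... | inj₂ s-is-X with refl ← T-does (s ≟ₚ (exit at g₃)) s-is-X =
        inj₂ (here (exit at g₃ , avoiding-sound ok , refl))

      prepend : ∀ {s q} → T (avoiding t s) → (same , q) ∈ ports s → Escape i t q → Escape i t s
      prepend {s} ok l∈ (inj₁ w) = inj₁ (step (s , avoiding-sound ok , refl) (local-edge i l∈) w)
      prepend {s} ok l∈ (inj₂ w) = inj₂ (step (s , avoiding-sound ok , refl) (local-edge i l∈) w)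

      open Sound (Escape i t) (λ {s} → at-exit {s}) (λ {s} {q} → prepend {s} {q})

  unit-of : Fin n → Fin K
  unit-of x = proj₁ (from x)

  in-unit : ∀ {j Ok x} → InUnit j Ok x → unit-of x ≡ j
  in-unit {j} (p , _ , refl) = cong proj₁ (from-to (j , p))

  Below : Fin K → Fin n → Set
  Below i x = toℕ (unit-of x) < toℕ i ⊎ x ≡ vertex i A

  -- From the A of unit i, walk down through units i-1, …, 0 to the A of unit 0, entering
  -- each unit at the exit of its gadget 3.
  descend : ∀ i → Walk G (Below i) (vertex i A) (vertex fzero A)
  descend = <-weakInduction (λ i → Walk G (Below i) (vertex i A) (vertex fzero A)) (here (inj₂ refl)) descend-one
    where
    descend-one : ∀ i → Walk G (Below (inject₁ i)) (vertex (inject₁ i) A) (vertex fzero A) →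
                  Walk G (Below (fsuc i)) (vertex (fsuc i) A) (vertex fzero A)
    descend-one i w =
      step (inj₂ refl) (port-edge (fsuc i) A back (exit at g₃) (there (there (here refl))))
        (weaken (λ x-in → inj₁ (below (in-unit x-in))) (to-A (inject₁ i) (exit at g₃)) ▸ weaken lower w)
      where
      step-down : toℕ (inject₁ i) < toℕ (fsuc i)
      step-down = s≤s (ℕ.≤-reflexive (toℕ-inject₁ i))
      below : ∀ {x} → unit-of x ≡ inject₁ i → toℕ (unit-of x) < toℕ (fsuc i)
      below e = subst (λ j → toℕ j < toℕ (fsuc i)) (≡-sym e) step-down
      lower : ∀ {x} → Below (inject₁ i) x → Below (fsuc i) x
      lower (inj₁ lt) = inj₁ (ℕ.<-trans lt step-down)
      lower (inj₂ refl) = inj₁ (below (in-unit {Ok = λ _ → ⊤} (A , tt , refl)))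

  L : Fin K
  L = fromℕ (suc m)

  module Hub (t : Pos) where

    avoids : ∀ {j Ok x} → (∀ {p} → Ok p → (j , p) ≢ (L , t)) → InUnit j Ok x → ¬ x ≡ vertex L t
    avoids allowed⇒≢ (p , ok , refl) e = allowed⇒≢ ok (vertex-injective e)

    local : ∀ {x} → InUnit L (_≢ t) x → ¬ x ≡ vertex L t
    local = avoids (λ p≢t e → p≢t (cong proj₂ e))

    below-avoids : ∀ i {x} → vertex i A ≢ vertex L t → Below i x → ¬ x ≡ vertex L t
    below-avoids i _ (inj₁ lt) refl =
      ℕ.<⇒≱ lt (subst (λ j → toℕ i ≤ toℕ j) (≡-sym (cong proj₁ (from-to (L , t))))
                   (subst (toℕ i ≤_) (≡-sym (toℕ-fromℕ (suc m))) (toℕ≤pred[n] i)))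
    below-avoids i A≢x (inj₂ refl) = A≢x

    wrap : Adj G (vertex L (exit at g₃)) (vertex fzero A)
    wrap = subst (λ j → Adj G (vertex L (exit at g₃)) (vertex j A)) next-last (port-edge L (exit at g₃) fwd A (here refl))

    -- unit 0 is not the last unit, since there are at least two units
    zero≢L : fzero ≢ L
    zero≢L ()

    -- Outside the last unit: walk to the local A and descend.  Inside it: escape to its A
    -- and descend, or escape to the exit of gadget 3 and wrap around to unit 0.
    to-hub : ∀ w → w ≢ (L , t) → Walk G (λ x → ¬ x ≡ vertex L t) (to w) (vertex fzero A)
    to-hub (i , s) w≢x with i ≟ L
    ... | no i≢L = weaken (avoids (λ _ e → i≢L (cong proj₁ e))) (to-A i s)
                   ▸ weaken (below-avoids i (λ e → i≢L (cong proj₁ (vertex-injective e)))) (descend i)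
    ... | yes refl with escape L t s (λ s≡t → w≢x (cong (L ,_) s≡t))
    ...   | inj₁ w = weaken local w ▸ weaken (below-avoids L (local (walk-end w))) (descend L)
    ...   | inj₂ w = weaken local w ▸ step (local (walk-end w)) wrap (here hub-avoids)
      where
      hub-avoids : ¬ vertex fzero A ≡ vertex L t
      hub-avoids e = zero≢L (cong proj₁ (vertex-injective e))

  -- G − (L , t) is connected: every vertex walks to the hub, the A of unit 0.
  robust-last : ∀ t → ConnectedWithout G (vertex L t)
  robust-last t u v u≢x v≢x = via-hub u u≢x ▸ reverse (via-hub v v≢x)
    where
    open Hub t
    via-hub : ∀ u → ¬ u ≡ vertex L t → Walk G (λ x → ¬ x ≡ vertex L t) u (vertex fzero A)
    via-hub u u≢x = subst (λ y → Walk G _ y (vertex fzero A)) (to-from u)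
                      (to-hub (from u) (λ e → u≢x (trans (≡-sym (to-from u)) (cong to e))))

  rotate unrotate : Vertex → Vertex
  rotate (i , p) = next i , p
  unrotate (i , p) = prev i , p

  nbrs-rotate : ∀ {u v} → v ∈ nbrs u → rotate v ∈ nbrs (rotate u)
  nbrs-rotate {i , p} v∈ with ∈-map⁻ (follow i) v∈
  ... | (o , q) , l∈ , refl = subst (λ j → (j , q) ∈ nbrs (next i , p)) (shift-next o i) (∈-map⁺ (follow (next i)) l∈)

  σ τ : Fin n → Fin n
  σ x = to (rotate (from x))
  τ x = to (unrotate (from x))

  σ-vertex : ∀ j t → σ (vertex j t) ≡ vertex (next j) t
  σ-vertex j t = cong (to ∘ rotate) (from-to (j , t))

  -- G − x is connected for every x: by rotation, it suffices to delete a vertex of the last unit.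
  robust : ∀ x → ConnectedWithout G x
  robust x = subst (ConnectedWithout G) (to-from x) (every-unit (proj₁ (from x)) (proj₂ (from x)))
    where
    στ : ∀ x → σ (τ x) ≡ x
    στ x rewrite from-to (unrotate (from x)) = trans (cong (λ j → to (j , proj₂ (from x))) (next-prev _)) (to-from x)
    τσ : ∀ x → τ (σ x) ≡ x
    τσ x rewrite from-to (rotate (from x)) = trans (cong (λ j → to (j , proj₂ (from x))) (prev-next _)) (to-from x)
    σ-adj : ∀ {x y} → Adj G x y → Adj G (σ x) (σ y)
    σ-adj e = ∈⇒adjacent (nbrs-rotate (adjacent⇒∈ e))
    every-unit : ∀ j t → ConnectedWithout G (vertex j t)
    every-unit = cyclic-induction (λ j → ∀ t → ConnectedWithout G (vertex j t)) robust-last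
      (λ j robust-j t → subst (ConnectedWithout G) (σ-vertex j t)
                                (robust-transport σ τ στ τσ σ-adj (vertex j t) (robust-j t)))

  two-connected : TwoConnected G
  two-connected =
    s≤s (s≤s (s≤s z≤n)) ,
    connected-if-robust (distinct A B (λ ())) (distinct A (entry at g₁) (λ ())) (distinct B (entry at g₁) (λ ())) robust ,
    robust
    where
    distinct : ∀ p q → p ≢ q → vertex fzero p ≢ vertex fzero q
    distinct p q p≢q e = p≢q (cong proj₂ (vertex-injective e))

  -- The blobs are the gadgets: the gadget vertices of unit i and gadget g form blob (i , g);
  -- A and B are connectors.
  blobᵥ : Vertex → Maybe (Fin K × Gadget)
  blobᵥ (i , p) = Maybe.map (i ,_) (gadget-of p)

  blob : Fin n → Maybe (Fin K × Gadget)
  blob x = blobᵥ (from x)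

  same-gadget : ∀ {i p o q ℓ ℓ′} → SameGadget p (o , q) →
                blobᵥ (i , p) ≡ just ℓ → blobᵥ (shift o i , q) ≡ just ℓ′ → ℓ ≡ ℓ′
  same-gadget {i} (inj₁ p-con) bp _ with () ← trans (≡-sym bp) (cong (Maybe.map (i ,_)) p-con)
  same-gadget {i} {o = o} (inj₂ (inj₁ q-con)) _ bq with () ← trans (≡-sym bq) (cong (Maybe.map (shift o i ,_)) q-con)
  same-gadget {i} (inj₂ (inj₂ (refl , q≡p))) bp bq =
    Maybe.just-injective (trans (≡-sym bp) (trans (cong (Maybe.map (i ,_)) (≡-sym q≡p)) bq))

  blob-edge : ∀ {x y ℓ ℓ′} → Adj G x y → blob x ≡ just ℓ → blob y ≡ just ℓ′ → ℓ ≡ ℓ′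
  blob-edge {x} e bx by with ∈-map⁻ (follow (proj₁ (from x))) (adjacent⇒∈ e)
  ... | (o , q) , l∈ , fy≡ =
    same-gadget (All.lookup (ports-gadgets (proj₂ (from x))) l∈) bx (trans (cong blobᵥ (≡-sym fy≡)) by)

  gadget-vertices : Fin K → Gadget → List (Fin n)
  gadget-vertices i g = map (λ c → vertex i (c at g)) (allFin 4)

  in-gadget : ∀ w {i g} → blobᵥ w ≡ just (i , g) → to w ∈ gadget-vertices i g
  in-gadget (j , inj₁ _) ()
  in-gadget (j , c at g) refl = ∈-map⁺ (λ c → vertex j (c at g)) (∈-allFin c)

  blob-size : ∀ ℓ {us} → Unique us → All (λ u → blob u ≡ just ℓ) us → length us ≤ 4
  blob-size (i , g) {us} unique in-blob =
    subst (length us ≤_) (trans (length-map (λ c → vertex i (c at g)) (allFin 4)) (length-tabulate (λ c → c)))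
      (unique-⊆-length unique (λ {u} u∈ → subst (_∈ gadget-vertices i g) (to-from u)
                                                (in-gadget (from u) (All.lookup in-blob u∈))))

  connector-vertices : List (Fin n)
  connector-vertices = map (λ j → vertex j A) (allFin K) ++ map (λ j → vertex j B) (allFin K)

  in-connectors : ∀ w → blobᵥ w ≡ nothing → to w ∈ connector-vertices
  in-connectors (j , A) _ = ∈-++⁺ˡ (∈-map⁺ (λ j → vertex j A) (∈-allFin j))
  in-connectors (j , B) _ = ∈-++⁺ʳ (map (λ j → vertex j A) (allFin K)) (∈-map⁺ (λ j → vertex j B) (∈-allFin j))
  in-connectors (j , _ at _) ()

  open BlobBound G blob blob-edge 4 blob-size

  few-connectors : ∀ {us} → Unique us → All IsConnector us → length us ≤ K + K
  few-connectors {us} unique connectors =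
    subst (length us ≤_) count
      (unique-⊆-length unique (λ {u} u∈ → subst (_∈ connector-vertices) (to-from u)
                                                (in-connectors (from u) (All.lookup connectors u∈))))
    where
    count : length connector-vertices ≡ K + K
    count = trans (length-++ (map (λ j → vertex j A) (allFin K)))
                  (cong₂ _+_ (trans (length-map (λ j → vertex j A) (allFin K)) (length-tabulate (λ j → j)))
                             (trans (length-map (λ j → vertex j B) (allFin K)) (length-tabulate (λ j → j))))

  many-paths : ∀ ps → PathCover G ps → n ≤ 14 * length ps
  many-paths ps cover = fourteen-bound K (length ps) (cover-bound (K + K) few-connectors cover)

theorem1p2 : ∀ (N : ℕ) → ∃[ n ] (N ≤ n × Σ (Graph n) (λ H → TwoConnected H × Cubic H × (∀ (ps : List (List (Fin n))) → PathCover H ps → n ≤ 14 * length ps)))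
theorem1p2 N = n , N≤n , G , two-connected , cubic , many-paths
  where
  open Construction N
  N≤n : N ≤ n
  N≤n = ℕ.≤-trans (ℕ.n≤1+n N) (ℕ.≤-trans (ℕ.n≤1+n (suc N)) (ℕ.m≤m*n (suc (suc N)) 14))
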